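{- In the $(1:1)$ WMaker--WBreaker Connectivity game on $E(K_n)$ in which WMaker makes the first move (WBreaker is the second player), WBreaker has a strategy ensuring that WMaker needs at least $n$ moves to win, i.e. the edges claimed by WMaker in her first $n-1$ moves do not contain a spanning tree of $K_n$.
   Context: The $(1:1)$ WMaker--WBreaker game on $E(K_n)$: two players, WMaker and WBreaker, alternately claim one edge of the complete graph $K_n$ per turn. Both players are walkers: at her/his first move a player chooses any vertex as starting position; when a player is positioned at a vertex $v$, she/he may only claim an edge incident with $v$ that has not previously been claimed by the opponent, and the other endpoint of the claimed edge becomes her/his new position. In the Connectivity game WMaker wins once her claimed edges contain the edge set of a spanning tree of $K_n$. -}

module Defs where

open import Data.Nat using (ℕ; zero; suc; _≤_; _<_; _∸_)
open import Data.Fin using (Fin)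
open import Data.List using (List; []; _∷_; _∷ʳ_; applyUpTo; length)
open import Data.List.Relation.Unary.Any using (Any)
open import Data.List.Relation.Unary.All using (All)
open import Data.List.Relation.Unary.AllPairs using (AllPairs)
open import Data.Product using (_×_; _,_; Σ)
open import Data.Sum using (_⊎_)
open import Relation.Binary.PropositionalEquality using (_≡_; _≢_)
open import Relation.Nullary using (¬_)

-- Vertices of K_n are Fin n; an edge {u,v} is represented by an ordered pair,
-- compared up to orientation.
Edge : ℕ → Set
Edge n = Fin n × Fin n

SameEdge : ∀ {n} → Edge n → Edge n → Set
SameEdge (a , b) (c , d) = (a ≡ c × b ≡ d) ⊎ (a ≡ d × b ≡ c)

_∈E_ : ∀ {n} → Edge n → List (Edge n) → Set
e ∈E E = Any (SameEdge e) E

edgesOf : ∀ {n} → List (Fin n) → List (Edge n)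
edgesOf (a ∷ b ∷ rest) = (a , b) ∷ edgesOf (b ∷ rest)
edgesOf _ = []

data Connected {n} (E : List (Edge n)) : Fin n → Fin n → Set where
  here : ∀ {u} → Connected E u u
  step : ∀ {u w v} → (u , w) ∈E E → Connected E w v → Connected E u v

SpanningTree : (n : ℕ) → List (Edge n) → Set
SpanningTree n T =
  All (λ e → Data.Product.proj₁ e ≢ Data.Product.proj₂ e) T
  × AllPairs (λ e f → ¬ SameEdge e f) T
  × length T ≡ n ∸ 1
  × (∀ u v → Connected T u v)

ContainsSpanningTree : (n : ℕ) → List (Edge n) → Set
ContainsSpanningTree n E =
  Σ (List (Edge n)) λ T → SpanningTree n T × All (λ e → e ∈E E) T

-- A (deterministic) WBreaker strategy, as second player.
-- startB : given WMaker's first move (start vertex v0, new position v1),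
--          WBreaker's starting vertex w0.
-- stepB  : given WMaker's walk so far v0 … v(j+1) and WBreaker's walk so far
--          w0 … wj, WBreaker's next position w(j+1) (i.e. she claims wj w(j+1)).
record BStrategy (n : ℕ) : Set where
  field
    startB : Fin n → Fin n → Fin n
    stepB  : List (Fin n) → List (Fin n) → Fin n
open BStrategy public

-- WMaker's play is given by her sequence of positions v : ℕ → Fin n
-- (v 0 = start vertex, her i-th move claims the edge v (i-1) v i).
makerWalk : ∀ {n} → (ℕ → Fin n) → ℕ → List (Fin n)
makerWalk v i = applyUpTo v (suc i)

module _ {n : ℕ} (σ : BStrategy n) (v : ℕ → Fin n) where
  -- WBreaker's walk w0 … wj after her j-th move (made after WMaker's j-th move)
  breakerWalk : ℕ → List (Fin n)
  breakerWalk zero = startB σ (v 0) (v 1) ∷ []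
  breakerWalk (suc j) = breakerWalk j ∷ʳ stepB σ (makerWalk v (suc j)) (breakerWalk j)

  breakerPos : ℕ → Fin n
  breakerPos zero = startB σ (v 0) (v 1)
  breakerPos (suc j) = stepB σ (makerWalk v (suc j)) (breakerWalk j)

  -- WMaker's i-th move (i ≥ 1) is legal: it claims an edge at her position
  -- not previously claimed by WBreaker (who has made i-1 moves so far).
  MakerLegal : ℕ → Set
  MakerLegal zero = ⊤' where open import Data.Unit using () renaming (⊤ to ⊤')
  MakerLegal (suc i) =
    (v i ≢ v (suc i)) × ¬ ((v i , v (suc i)) ∈E edgesOf (breakerWalk i))

  BreakerLegal : ℕ → Set
  BreakerLegal zero = ⊤' where open import Data.Unit using () renaming (⊤ to ⊤')
  BreakerLegal (suc j) =
    (breakerPos j ≢ breakerPos (suc j))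
    × ¬ ((breakerPos j , breakerPos (suc j)) ∈E edgesOf (makerWalk v (suc j)))

-- Breaker always stands on a vertex Maker has not visited yet and from there
-- walks on to another unvisited vertex; when her own vertex is the only
-- unvisited one left she steps onto Maker's position instead.  A spanning
-- tree inside n-1 Maker edges forces Maker's walk to visit a new vertex at
-- every move, so before her last move exactly one vertex u is unvisited and
-- Breaker, standing on u or on Maker's position, has just claimed the edge
-- joining Maker's position to u: Maker cannot make her last move.
module Submission where

open import Defs
open import Data.Nat using (ℕ; zero; suc; _+_; _≤_; _<_; _∸_; s≤s; z≤n)
open import Data.Fin using (Fin)
open import Data.Nat.Properties using (≤-antisym; <⇒≱; ≤-pred; ≤-trans; ≤-refl; ≤-reflexive; n<1+n)
import Data.Fin as Fin
open import Data.Fin.Properties using (any?; injective⇒≤) renaming (_≟_ to _≟ᶠ_)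
open import Data.List using (List; []; _∷_; _∷ʳ_; foldl; applyUpTo; length)
open import Data.List.Properties using (length-applyUpTo; applyUpTo-∷ʳ; foldl-∷ʳ)
open import Data.List.Relation.Unary.Any using (here; there; map)
open import Data.List.Relation.Unary.All using (All; _∷_)
open import Data.List.Membership.Propositional using (_∈_; _∉_)
open import Data.List.Membership.Propositional.Properties
  using (∈-applyUpTo⁺; ∈-++⁻)
import Data.List.Membership.DecPropositional as DecMembership
import Data.List.Membership.Setoid.Properties as SetoidMembership
open import Data.Product using (Σ; _×_; _,_; proj₁; proj₂; ∃)
open import Data.Sum using (inj₁; inj₂; _⊎_)
open import Data.Empty using (⊥-elim)
open import Relation.Nullary using (¬_; Dec; yes; no; ¬?)
open import Relation.Nullary.Decidable using (decidable-stable)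
open import Relation.Binary.PropositionalEquality

_∈?_ : ∀ {n} (y : Fin n) (xs : List (Fin n)) → Dec (y ∈ xs)
_∈?_ = DecMembership._∈?_ _≟ᶠ_

covering⇒≤length : ∀ {n} (xs : List (Fin n)) → (∀ y → y ∈ xs) → n ≤ length xs
covering⇒≤length {n} xs cover = injective⇒≤ λ {y} {z} →
  SetoidMembership.index-injective (setoid (Fin n)) (cover y) (cover z)

¬∃∉⇒covering : ∀ {n} (xs : List (Fin n)) → ¬ (∃ λ y → y ∉ xs) → ∀ y → y ∈ xs
¬∃∉⇒covering xs noFresh y = decidable-stable (y ∈? xs) (λ y∉ → noFresh (y , y∉))

length<⇒∃∉ : ∀ {n} (xs : List (Fin n)) → length xs < n → ∃ λ y → y ∉ xs
length<⇒∃∉ xs short with any? (λ y → ¬? (y ∈? xs))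
... | yes fresh = fresh
... | no noFresh = ⊥-elim (<⇒≱ short (covering⇒≤length xs (¬∃∉⇒covering xs noFresh)))

∈-applyUpTo-suc⁻ : ∀ {A : Set} (w : ℕ → A) k {y} →
  y ∈ applyUpTo w (suc k) → y ∈ applyUpTo w k ⊎ y ≡ w k
∈-applyUpTo-suc⁻ w k y∈ rewrite sym (applyUpTo-∷ʳ w k) with ∈-++⁻ (applyUpTo w k) y∈
... | inj₁ y∈init = inj₁ y∈init
... | inj₂ (here y≡wk) = inj₂ y≡wk

lastOr : ∀ {A : Set} → A → List A → A
lastOr = foldl (λ _ x → x)

lastOr-applyUpTo : ∀ {A : Set} (d : A) (w : ℕ → A) k → lastOr d (applyUpTo w (suc k)) ≡ w k
lastOr-applyUpTo d w k = begin
  lastOr d (applyUpTo w (suc k))     ≡⟨ cong (lastOr d) (sym (applyUpTo-∷ʳ w k)) ⟩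
  lastOr d (applyUpTo w k ∷ʳ w k)    ≡⟨ foldl-∷ʳ (λ _ x → x) d (w k) (applyUpTo w k) ⟩
  w k                                ∎
  where open ≡-Reasoning

SameEdge-trans : ∀ {n} {e f g : Edge n} → SameEdge e f → SameEdge f g → SameEdge e g
SameEdge-trans (inj₁ (refl , refl)) s = s
SameEdge-trans (inj₂ (refl , refl)) (inj₁ (refl , refl)) = inj₂ (refl , refl)
SameEdge-trans (inj₂ (refl , refl)) (inj₂ (refl , refl)) = inj₁ (refl , refl)

∈E-resp : ∀ {n} {e f : Edge n} {E} → SameEdge e f → f ∈E E → e ∈E E
∈E-resp e~f = map (SameEdge-trans e~f)

∈E-⊆ : ∀ {n} {e : Edge n} {E F} → All (_∈E F) E → e ∈E E → e ∈E F
∈E-⊆ (f∈F ∷ _) (here e~f) = ∈E-resp e~f f∈F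
∈E-⊆ (_ ∷ E⊆F) (there e∈E) = ∈E-⊆ E⊆F e∈E

∈E-edgesOf⇒∈ : ∀ {n} (W : List (Fin n)) {a b} → (a , b) ∈E edgesOf W → a ∈ W × b ∈ W
∈E-edgesOf⇒∈ (x ∷ y ∷ W) (here (inj₁ (refl , refl))) = here refl , there (here refl)
∈E-edgesOf⇒∈ (x ∷ y ∷ W) (here (inj₂ (refl , refl))) = there (here refl) , here refl
∈E-edgesOf⇒∈ (x ∷ y ∷ W) (there ab∈) with ∈E-edgesOf⇒∈ (y ∷ W) ab∈
... | a∈ , b∈ = there a∈ , there b∈

∈E-edgesOf-applyUpTo : ∀ {n} (w : ℕ → Fin n) {i k} → i < k →
  (w i , w (suc i)) ∈E edgesOf (applyUpTo w (suc k))
∈E-edgesOf-applyUpTo w {zero} {suc k} _ = here (inj₁ (refl , refl))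
∈E-edgesOf-applyUpTo w {suc i} {suc k} (s≤s i<k) =
  there (∈E-edgesOf-applyUpTo (λ j → w (suc j)) i<k)

Connected-edgesOf⇒∈ : ∀ {n} {W : List (Fin n)} {T a b} →
  All (_∈E edgesOf W) T → Connected T a b → a ∈ W → b ∈ W
Connected-edgesOf⇒∈ T⊆ here a∈W = a∈W
Connected-edgesOf⇒∈ {W = W} T⊆ (step ac∈T c⇝b) a∈W =
  Connected-edgesOf⇒∈ T⊆ c⇝b (proj₂ (∈E-edgesOf⇒∈ W (∈E-⊆ T⊆ ac∈T)))

ContainsSpanningTree-edgesOf⇒covering : ∀ {n} {W : List (Fin n)} {a} →
  ContainsSpanningTree n (edgesOf W) → a ∈ W → ∀ y → y ∈ W
ContainsSpanningTree-edgesOf⇒covering {a = a} (T , (_ , _ , _ , connected) , T⊆) a∈W y =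
  Connected-edgesOf⇒∈ T⊆ (connected a y) a∈W

-- Breaker's move from x when Maker has visited W and stands at m.
chase : ∀ {n} → Fin n → Fin n → List (Fin n) → Fin n
chase x m W with any? (λ y → ¬? (y ∈? (x ∷ W)))
... | yes (y , _) = y
... | no _ = m

data ChaseView {n} (x m : Fin n) (W : List (Fin n)) : Fin n → Set where
  fresh : ∀ {y} → y ∉ x ∷ W → ChaseView x m W y
  stuck : (∀ y → y ∈ x ∷ W) → ChaseView x m W m

chaseView : ∀ {n} (x m : Fin n) W → ChaseView x m W (chase x m W)
chaseView x m W with any? (λ y → ¬? (y ∈? (x ∷ W)))
... | yes (y , y∉) = fresh y∉
... | no noFresh = stuck (¬∃∉⇒covering (x ∷ W) noFresh)

chase-∉ : ∀ {n} (x m : Fin n) W → 2 + length W ≤ n → chase x m W ∉ W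
chase-∉ x m W roomy with chase x m W | chaseView x m W
... | _ | fresh y∉ = λ y∈ → y∉ (there y∈)
... | _ | stuck cover = ⊥-elim (<⇒≱ roomy (covering⇒≤length (x ∷ W) cover))

chase-legal : ∀ {n} (x m : Fin n) W → length W < n → m ∈ W →
  x ≢ chase x m W × ¬ ((x , chase x m W) ∈E edgesOf W)
chase-legal x m W short m∈W with chase x m W | chaseView x m W
... | _ | fresh y∉ = (λ x≡y → y∉ (here (sym x≡y)))
                   , (λ xy∈ → y∉ (there (proj₂ (∈E-edgesOf⇒∈ W xy∈))))
... | _ | stuck cover with length<⇒∃∉ W short
...   | y , y∉W with cover y
...     | there y∈W = ⊥-elim (y∉W y∈W)
...     | here refl = (λ { refl → y∉W m∈W })
                    , (λ xm∈ → y∉W (proj₁ (∈E-edgesOf⇒∈ W xm∈)))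

chase-closes : ∀ {n} {x m u : Fin n} {W} →
  (∀ y → y ∈ u ∷ W) → u ∉ W → (x ∈ W → x ≡ m) → SameEdge (m , u) (x , chase x m W)
chase-closes {x = x} {m} {W = W} cover u∉W onlyM with chase x m W | chaseView x m W
... | _ | stuck coverx with coverx _
...   | here u≡x = inj₂ (refl , u≡x)
...   | there u∈W = ⊥-elim (u∉W u∈W)
chase-closes {x = x} cover u∉W onlyM | _ | fresh y∉ with cover _ | cover x
... | there y∈W | _ = ⊥-elim (y∉ (there y∈W))
... | here refl | here refl = ⊥-elim (y∉ (here refl))
... | here refl | there x∈W = inj₁ (sym (onlyM x∈W) , refl)

-- stepB only ever receives nonempty walks, so the default Fin.zero is never read.
breaker : ∀ {n} → BStrategy (suc n)
breaker = record
  { startB = λ v₀ _ → chase v₀ v₀ (v₀ ∷ [])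
  ; stepB  = λ W B → chase (lastOr Fin.zero B) (lastOr Fin.zero W) W
  }

module Play (i : ℕ) (v : ℕ → Fin (3 + i)) where

  pos : ℕ → Fin (3 + i)
  pos = breakerPos breaker v

  breakerWalk≡applyUpTo : ∀ j → breakerWalk breaker v j ≡ applyUpTo pos (suc j)
  breakerWalk≡applyUpTo zero = refl
  breakerWalk≡applyUpTo (suc j) = begin
    breakerWalk breaker v j ∷ʳ pos (suc j)  ≡⟨ cong (_∷ʳ pos (suc j)) (breakerWalk≡applyUpTo j) ⟩
    applyUpTo pos (suc j) ∷ʳ pos (suc j)    ≡⟨ applyUpTo-∷ʳ pos (suc j) ⟩
    applyUpTo pos (suc (suc j))             ∎
    where open ≡-Reasoning

  pos-suc : ∀ j → pos (suc j) ≡ chase (pos j) (v (suc j)) (makerWalk v (suc j))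
  pos-suc j = cong₂ (λ x m → chase x m (makerWalk v (suc j)))
    (trans (cong (lastOr Fin.zero) (breakerWalk≡applyUpTo j)) (lastOr-applyUpTo Fin.zero pos j))
    (lastOr-applyUpTo Fin.zero v (suc j))

  v∈makerWalk : ∀ j → v j ∈ makerWalk v j
  v∈makerWalk j = ∈-applyUpTo⁺ v (n<1+n j)

  length-makerWalk : ∀ j → length (makerWalk v j) ≡ suc j
  length-makerWalk j = length-applyUpTo v (suc j)

  pos-∉ : ∀ j → j ≤ i → pos j ∉ makerWalk v j
  pos-∉ zero _ = chase-∉ (v 0) (v 0) (v 0 ∷ []) (s≤s (s≤s (s≤s z≤n)))
  pos-∉ (suc j) j<i = subst (_∉ makerWalk v (suc j)) (sym (pos-suc j))
    (chase-∉ (pos j) (v (suc j)) (makerWalk v (suc j)) roomy)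
    where
    roomy : 2 + length (makerWalk v (suc j)) ≤ 3 + i
    roomy rewrite length-makerWalk (suc j) = s≤s (s≤s (s≤s j<i))

  breaker-legal : ∀ j → j ≤ i → BreakerLegal breaker v (suc j)
  breaker-legal j j≤i =
    subst (λ p → pos j ≢ p × ¬ ((pos j , p) ∈E edgesOf (makerWalk v (suc j))))
      (sym (pos-suc j))
      (chase-legal (pos j) (v (suc j)) (makerWalk v (suc j)) short (v∈makerWalk (suc j)))
    where
    short : length (makerWalk v (suc j)) < 3 + i
    short rewrite length-makerWalk (suc j) = s≤s (s≤s (s≤s j≤i))

  maker-blocked : (∀ y → y ∈ makerWalk v (2 + i)) → ¬ MakerLegal breaker v (2 + i)
  maker-blocked cover (_ , notBreakers) = notBreakers breakerClaimed
    where
    W = makerWalk v (suc i)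

    cover-u∷W : ∀ y → y ∈ v (2 + i) ∷ W
    cover-u∷W y with ∈-applyUpTo-suc⁻ v (2 + i) (cover y)
    ... | inj₁ y∈W = there y∈W
    ... | inj₂ refl = here refl

    u∉W : v (2 + i) ∉ W
    u∉W u∈W = <⇒≱ (s≤s (≤-reflexive (length-makerWalk (suc i))))
      (covering⇒≤length W λ y → coverWith y (cover-u∷W y))
      where
      coverWith : ∀ y → y ∈ v (2 + i) ∷ W → y ∈ W
      coverWith y (here refl) = u∈W
      coverWith y (there y∈W) = y∈W

    onlyM : pos i ∈ W → pos i ≡ v (suc i)
    onlyM x∈W with ∈-applyUpTo-suc⁻ v (suc i) x∈W
    ... | inj₁ x∈earlier = ⊥-elim (pos-∉ i ≤-refl x∈earlier)
    ... | inj₂ x≡m = x≡m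

    lastBreakerEdge : (pos i , pos (suc i)) ∈E edgesOf (breakerWalk breaker v (suc i))
    lastBreakerEdge = subst (λ B → (pos i , pos (suc i)) ∈E edgesOf B)
      (sym (breakerWalk≡applyUpTo (suc i))) (∈E-edgesOf-applyUpTo pos (n<1+n i))

    breakerClaimed : (v (suc i) , v (2 + i)) ∈E edgesOf (breakerWalk breaker v (suc i))
    breakerClaimed = ∈E-resp
      (subst (λ p → SameEdge (v (suc i) , v (2 + i)) (pos i , p)) (sym (pos-suc i))
        (chase-closes cover-u∷W u∉W onlyM))
      lastBreakerEdge

  no-spanning-tree : ∀ k → k ≤ 2 + i → (∀ j → 1 ≤ j → j ≤ k → MakerLegal breaker v j) →
    ¬ ContainsSpanningTree (3 + i) (edgesOf (makerWalk v k))
  no-spanning-tree k k≤ legal spanning = maker-blocked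
    (subst (λ k → ∀ y → y ∈ makerWalk v k) k≡ cover)
    (legal (2 + i) (s≤s z≤n) (≤-reflexive (sym k≡)))
    where
    cover : ∀ y → y ∈ makerWalk v k
    cover = ContainsSpanningTree-edgesOf⇒covering spanning (here refl)
    k≡ : k ≡ 2 + i
    k≡ = ≤-antisym k≤ (≤-pred (subst (3 + i ≤_) (length-makerWalk k) (covering⇒≤length _ cover)))

theorem3 : (n : ℕ) → 3 ≤ n →
    Σ (BStrategy n) λ σ →
      (v : ℕ → Fin n) (k : ℕ) → k ≤ n ∸ 1 →
      (∀ i → 1 ≤ i → i ≤ k → MakerLegal σ v i) →
      (∀ j → 1 ≤ j → j < k → BreakerLegal σ v j)
      × ¬ ContainsSpanningTree n (edgesOf (makerWalk v k))
theorem3 (suc (suc (suc i))) (s≤s (s≤s (s≤s z≤n))) = breaker , λ v k k≤ makerLegal →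
    (λ { (suc j) _ j<k → Play.breaker-legal i v j (≤-pred (≤-pred (≤-trans j<k k≤))) })
  , Play.no-spanning-tree i v k k≤ makerLegal
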